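{- Let $\mathbf{L}=\langle L,G,H,F,P\rangle$ be a tense ICRDL-algebra and $(a,b)\in K(L)$. Then: (1) $G_K(a,b),H_K(a,b)\in K(L)$; (2) $F_K(a,b)=\sim G_K(\sim(a,b))$ and $P_K(a,b)=\sim H_K(\sim(a,b))$; (3) $F_K(a,b),P_K(a,b)\in K(L)$.
   Context: An ICRDL-algebra is a structure $\langle L,\vee,\wedge,\cdot,\to,0,1\rangle$ such that $\langle L,\vee,\wedge,0,1\rangle$ is a bounded distributive lattice, $\langle L,\cdot,1\rangle$ is a commutative monoid, and $x\cdot y\le z$ iff $x\le y\to z$. A tense ICRDL-algebra is an ICRDL-algebra with unary operations $G,H,F,P$ satisfying: (T1) $P(x)\le y$ iff $x\le G(y)$; (T2) $F(x)\le y$ iff $x\le H(y)$; (T3) $G(0)=0$, $H(0)=0$; (T4) $G(x)\cdot F(y)\le F(x\cdot y)$ and $H(x)\cdot P(y)\le P(x\cdot y)$; (T5) $G(x\vee y)\le G(x)\vee F(y)$ and $H(x\vee y)\le H(x)\vee P(y)$; (T6) $G(x\to y)\le G(x)\to G(y)$ and $H(x\to y)\le H(x)\to H(y)$. $K(L)=\{(a,b)\in L\times L: a\cdot b=0\}$, $\sim(a,b)=(b,a)$, and for $(a,b)\in L\times L$: $G_K(a,b)=(G(a),F(b))$, $H_K(a,b)=(H(a),P(b))$, $F_K(a,b)=(F(a),G(b))$, $P_K(a,b)=(P(a),H(b))$. -}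

module Defs where

open import Level using (Level; suc; _⊔_)
open import Relation.Binary.PropositionalEquality using (_≡_)
open import Data.Product using (_×_; _,_; Σ)
open import Function.Bundles using (_⇔_)

record ICRDL (ℓ : Level) : Set (suc ℓ) where
  infixr 6 _∨_
  infixr 7 _∧_
  infixl 8 _·_
  infixr 5 _⇒_
  infix 4 _≤_
  field
    Carrier : Set ℓ
    _∨_ _∧_ _·_ _⇒_ : Carrier → Carrier → Carrier
    𝟘 𝟙 : Carrier
    ∨-comm  : ∀ x y → x ∨ y ≡ y ∨ x
    ∧-comm  : ∀ x y → x ∧ y ≡ y ∧ x
    ∨-assoc : ∀ x y z → (x ∨ y) ∨ z ≡ x ∨ (y ∨ z)
    ∧-assoc : ∀ x y z → (x ∧ y) ∧ z ≡ x ∧ (y ∧ z)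
    ∨-absorbs-∧ : ∀ x y → x ∨ (x ∧ y) ≡ x
    ∧-absorbs-∨ : ∀ x y → x ∧ (x ∨ y) ≡ x
    ∧-distrib-∨ : ∀ x y z → x ∧ (y ∨ z) ≡ (x ∧ y) ∨ (x ∧ z)
    𝟘-least : ∀ x → 𝟘 ∧ x ≡ 𝟘
    𝟙-greatest : ∀ x → x ∧ 𝟙 ≡ x
    ·-assoc : ∀ x y z → (x · y) · z ≡ x · (y · z)
    ·-comm  : ∀ x y → x · y ≡ y · x
    ·-identityˡ : ∀ x → 𝟙 · x ≡ x

  _≤_ : Carrier → Carrier → Set ℓ
  x ≤ y = x ∧ y ≡ x

  field
    residuation : ∀ x y z → (x · y ≤ z) ⇔ (x ≤ y ⇒ z)

record TenseICRDL (ℓ : Level) : Set (suc ℓ) where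
  field
    icrdl : ICRDL ℓ
  open ICRDL icrdl public
  field
    G H F P : Carrier → Carrier
    T1 : ∀ x y → (P x ≤ y) ⇔ (x ≤ G y)
    T2 : ∀ x y → (F x ≤ y) ⇔ (x ≤ H y)
    T3G : G 𝟘 ≡ 𝟘
    T3H : H 𝟘 ≡ 𝟘
    T4G : ∀ x y → G x · F y ≤ F (x · y)
    T4H : ∀ x y → H x · P y ≤ P (x · y)
    T5G : ∀ x y → G (x ∨ y) ≤ G x ∨ F y
    T5H : ∀ x y → H (x ∨ y) ≤ H x ∨ P y
    T6G : ∀ x y → G (x ⇒ y) ≤ G x ⇒ G y
    T6H : ∀ x y → H (x ⇒ y) ≤ H x ⇒ H y

module TenseK {ℓ : Level} (𝐋 : TenseICRDL ℓ) where
  open TenseICRDL 𝐋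

  InK : Carrier × Carrier → Set ℓ
  InK (a , b) = a · b ≡ 𝟘

  ∼ : Carrier × Carrier → Carrier × Carrier
  ∼ (a , b) = (b , a)

  G_K H_K F_K P_K : Carrier × Carrier → Carrier × Carrier
  G_K (a , b) = (G a , F b)
  H_K (a , b) = (H a , P b)
  F_K (a , b) = (F a , G b)
  P_K (a , b) = (P a , H b)

{-# OPTIONS --safe #-}
module Submission where

open import Defs
open import Level using (Level)
open import Relation.Binary.PropositionalEquality using (_≡_; refl; sym; trans; cong; subst)
open import Data.Product using (_×_; _,_)
open import Function.Bundles using (_⇔_; Equivalence)

module ICRDLProperties {ℓ : Level} (𝐀 : ICRDL ℓ) where
  open ICRDL 𝐀

  x≤𝟘⇒x≡𝟘 : ∀ {x} → x ≤ 𝟘 → x ≡ 𝟘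
  x≤𝟘⇒x≡𝟘 {x} x∧𝟘≡x = trans (sym x∧𝟘≡x) (trans (∧-comm x 𝟘) (𝟘-least x))

  lowerAdjoint-𝟘 : (f g : Carrier → Carrier) → (∀ x y → (f x ≤ y) ⇔ (x ≤ g y)) →
                   f 𝟘 ≡ 𝟘
  lowerAdjoint-𝟘 f g adj = x≤𝟘⇒x≡𝟘 (Equivalence.from (adj 𝟘 𝟘) (𝟘-least (g 𝟘)))

  ·-annihilates-sym : ∀ {a b} → a · b ≡ 𝟘 → b · a ≡ 𝟘
  ·-annihilates-sym {a} {b} ab≡𝟘 = trans (·-comm b a) ab≡𝟘

  ·-annihilates-preserved : (h k : Carrier → Carrier) → k 𝟘 ≡ 𝟘 →
                            (∀ x y → h x · k y ≤ k (x · y)) →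
                            ∀ {a b} → a · b ≡ 𝟘 → h a · k b ≡ 𝟘
  ·-annihilates-preserved h k k𝟘≡𝟘 mult {a} {b} ab≡𝟘 =
    x≤𝟘⇒x≡𝟘 (subst (h a · k b ≤_) (trans (cong k ab≡𝟘) k𝟘≡𝟘) (mult a b))

module TenseKProperties {ℓ : Level} (𝐋 : TenseICRDL ℓ) where
  open TenseICRDL 𝐋
  open TenseK 𝐋
  open ICRDLProperties icrdl

  F-𝟘 : F 𝟘 ≡ 𝟘
  F-𝟘 = lowerAdjoint-𝟘 F H T2

  P-𝟘 : P 𝟘 ≡ 𝟘
  P-𝟘 = lowerAdjoint-𝟘 P G T1

  InK-∼ : ∀ {p} → InK p → InK (∼ p)
  InK-∼ = ·-annihilates-sym

  InK-G_K : ∀ {p} → InK p → InK (G_K p)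
  InK-G_K = ·-annihilates-preserved G F F-𝟘 T4G

  InK-H_K : ∀ {p} → InK p → InK (H_K p)
  InK-H_K = ·-annihilates-preserved H P P-𝟘 T4H

  F_K≡∼G_K∼ : ∀ p → F_K p ≡ ∼ (G_K (∼ p))
  F_K≡∼G_K∼ (a , b) = refl

  P_K≡∼H_K∼ : ∀ p → P_K p ≡ ∼ (H_K (∼ p))
  P_K≡∼H_K∼ (a , b) = refl

  InK-F_K : ∀ {p} → InK p → InK (F_K p)
  InK-F_K {p} p∈K =
    subst InK (sym (F_K≡∼G_K∼ p)) (InK-∼ (InK-G_K (InK-∼ p∈K)))

  InK-P_K : ∀ {p} → InK p → InK (P_K p)
  InK-P_K {p} p∈K =
    subst InK (sym (P_K≡∼H_K∼ p)) (InK-∼ (InK-H_K (InK-∼ p∈K)))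

mainTheorem8 : ∀ {ℓ : Level} (𝐋 : TenseICRDL ℓ) (a b : TenseICRDL.Carrier 𝐋) →
    let open TenseK 𝐋 in
    InK (a , b) →
      ((InK (G_K (a , b)) × InK (H_K (a , b)))
      × ((F_K (a , b) ≡ ∼ (G_K (∼ (a , b)))) × (P_K (a , b) ≡ ∼ (H_K (∼ (a , b)))))
      × (InK (F_K (a , b)) × InK (P_K (a , b))))
mainTheorem8 𝐋 a b ab∈K =
    (InK-G_K ab∈K , InK-H_K ab∈K)
  , (F_K≡∼G_K∼ (a , b) , P_K≡∼H_K∼ (a , b))
  , (InK-F_K ab∈K , InK-P_K ab∈K)
  where open TenseKProperties 𝐋
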